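{- Let $\theta$ be a linear operator on $\Lambda$. Then $E^a\theta=\theta E^a$ for all complex numbers $a$ if and only if $\theta$ is a complex formal power series in the iterated symmetric derivatives $\mathbf D_1,\mathbf D_2,\dots$.
   Context: $\Lambda$ is the algebra of symmetric functions over $\mathbb C$ in variables $\mathbf y=(y_1,y_2,\dots)$, with monomial basis $m_\lambda$ indexed by partitions $\lambda$. For $i\ge1$ the $i$-th symmetric derivative $\mathbf D_i$ is the linear operator with $\mathbf D_i m_\lambda=i!\,m_{\lambda\setminus i}$ if $i$ is a part of $\lambda$ (where $\lambda\setminus i$ removes one part equal to $i$) and $\mathbf D_im_\lambda=0$ otherwise. For $a\in\mathbb C$ the symmetric shift is $E^ap(y_1,y_2,\dots)=p(a,y_1,y_2,\dots)$. A formal power series in the $\mathbf D_i$ is an infinite linear combination $\sum_\nu c_\nu\prod_i\mathbf D_{\nu_i}$ over partitions $\nu$, acting on each symmetric function with only finitely many nonzero terms. -}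

module Defs where

open import Level using (_⊔_) renaming (suc to lsuc)
open import Data.Nat using (ℕ; zero; suc; _≤_; _≥_; _∸_; _<_; z≤n; s≤s; _!) renaming (_⊔_ to _⊔ℕ_)
  renaming (_≟_ to _≟ℕ_)
open import Data.Nat.Properties using (≤-trans; _≤?_)

open import Data.List using (List; []; _∷_; map; concatMap; foldr; upTo; mapMaybe; deduplicate; _++_)
open import Data.List.Properties using (≡-dec)
open import Data.List.Relation.Unary.Linked using (Linked; []; [-]; _∷_; linked?)
open import Data.List.Relation.Unary.All using (All; []; _∷_; all?)
open import Data.List.Relation.Unary.Any using (any?)
open import Data.List.Membership.Propositional using (_∈_)
open import Data.Nat.ListAction using (sum)
open import Data.Maybe using (Maybe; just; nothing)
open import Data.Product using (Σ; ∃; _×_; _,_; proj₁; proj₂)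
open import Relation.Nullary using (¬_; Dec; yes; no; does)
open import Relation.Binary.PropositionalEquality using (_≡_; refl)
open import Algebra.Bundles using (CommutativeRing)
open import Data.Bool using (if_then_else_)

-- Scalars: a field of characteristic zero (stand-in for ℂ)

module _ {c ℓ} (R : CommutativeRing c ℓ) where
  open CommutativeRing R
  ringFromℕ : ℕ → Carrier
  ringFromℕ zero    = 0#
  ringFromℕ (suc n) = 1# + ringFromℕ n

record CharZeroField c ℓ : Set (lsuc (c ⊔ ℓ)) where
  field
    commRing : CommutativeRing c ℓ
  open CommutativeRing commRing public
  field
    inverse  : ∀ x → ¬ (x ≈ 0#) → ∃ λ y → x * y ≈ 1#
    charZero : ∀ n → ¬ (ringFromℕ commRing (suc n) ≈ 0#)

record Partition : Set where
  constructor mkPartition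
  field
    parts : List ℕ
    decr  : Linked _≥_ parts
    pos   : All (1 ≤_) parts
open Partition public

isPartition? : (l : List ℕ) → Maybe Partition
isPartition? l with linked? (λ x y → y ≤? x) l | all? (1 ≤?_) l
... | yes d | yes p = just (mkPartition l d p)
... | _     | _     = nothing

size : Partition → ℕ
size λ′ = sum (parts λ′)

removeOne : ℕ → List ℕ → List ℕ
removeOne i [] = []
removeOne i (x ∷ xs) with i ≟ℕ x
... | yes _ = xs
... | no  _ = x ∷ removeOne i xs

private
  removeOne-linked : ∀ i x xs → Linked _≥_ (x ∷ xs) → Linked _≥_ (x ∷ removeOne i xs)
  removeOne-linked i x [] l = [-]
  removeOne-linked i x (y ∷ ys) (x≥y ∷ l) with i ≟ℕ y
  removeOne-linked i x (y ∷ []) (x≥y ∷ l) | yes _ = [-]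
  removeOne-linked i x (y ∷ z ∷ zs) (x≥y ∷ (y≥z ∷ l)) | yes _ = ≤-trans y≥z x≥y ∷ l
  ... | no _ = x≥y ∷ removeOne-linked i y ys l

  removeOne-linked′ : ∀ i xs → Linked _≥_ xs → Linked _≥_ (removeOne i xs)
  removeOne-linked′ i [] l = l
  removeOne-linked′ i (x ∷ xs) l with i ≟ℕ x
  removeOne-linked′ i (x ∷ []) l | yes _ = []
  removeOne-linked′ i (x ∷ y ∷ ys) (_ ∷ l) | yes _ = l
  ... | no _ = removeOne-linked i x xs l

  removeOne-all : ∀ {P : ℕ → Set} i xs → All P xs → All P (removeOne i xs)
  removeOne-all i [] a = a
  removeOne-all i (x ∷ xs) (px ∷ a) with i ≟ℕ x
  ... | yes _ = a
  ... | no  _ = px ∷ removeOne-all i xs a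

-- λ ∖ i  (remove one part equal to i; identity if i is not a part)
removePart : ℕ → Partition → Partition
removePart i (mkPartition l d p) =
  mkPartition (removeOne i l) (removeOne-linked′ i l d) (removeOne-all i l p)

-- all lists of positive integers with sum ≤ n (fuel argument bounds length)
compositions : ℕ → ℕ → List (List ℕ)
compositions zero       n = [] ∷ []
compositions (suc fuel) n =
  [] ∷ concatMap (λ k → map (suc k ∷_) (compositions fuel (n ∸ suc k))) (upTo n)

-- every partition ν with |ν| ≤ n, each exactly once
partitionsUpTo : ℕ → List Partition
partitionsUpTo n = mapMaybe isPartition? (compositions n n)

-- Λ over K, in the monomial basis

module Sym {c ℓ} (K : CharZeroField c ℓ) where
  open CharZeroField K

  fromℕ : ℕ → Carrier
  fromℕ = ringFromℕ commRing

  pow : Carrier → ℕ → Carrier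
  pow a zero    = 1#
  pow a (suc n) = a * pow a n

  -- an element of Λ is a finite formal sum  Σ k · m_λ  (list of terms)
  Λ : Set c
  Λ = List (Carrier × Partition)

  m : Partition → Λ
  m λ′ = (1# , λ′) ∷ []

  coeff : Λ → Partition → Carrier
  coeff [] μ = 0#
  coeff ((k , λ′) ∷ f) μ =
    (if does (≡-dec _≟ℕ_ (parts λ′) (parts μ)) then k else 0#) + coeff f μ

  infix 4 _≈Λ_
  _≈Λ_ : Λ → Λ → Set ℓ
  f ≈Λ g = ∀ μ → coeff f μ ≈ coeff g μ

  -- vector space operations (addition is _++_, zero is [])
  scale : Carrier → Λ → Λ
  scale k = map (λ t → (k * proj₁ t , proj₂ t))

  record LinOp : Set (c ⊔ ℓ) where
    field
      fun      : Λ → Λ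
      fun-cong : ∀ {f g} → f ≈Λ g → fun f ≈Λ fun g
      additive : ∀ f g → fun (f ++ g) ≈Λ fun f ++ fun g
      homog    : ∀ k f → fun (scale k f) ≈Λ scale k (fun f)
  open LinOp public

  D : ℕ → Λ → Λ
  D i = concatMap term
    where
    term : Carrier × Partition → Λ
    term (k , λ′) with any? (i ≟ℕ_) (parts λ′)
    ... | yes _ = (k * fromℕ (i !) , removePart i λ′) ∷ []
    ... | no  _ = []

  Dν : Partition → Λ → Λ
  Dν ν f = foldr D f (parts ν)

  deg : Λ → ℕ
  deg = foldr (λ t n → size (proj₂ t) ⊔ℕ n) 0

  -- the formal power series Σ_ν c_ν D_ν applied to f; all terms with |ν| > deg f
  -- vanish, so the (infinite) sum is the finite sum over |ν| ≤ deg f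
  series : (Partition → Carrier) → Λ → Λ
  series cf f = concatMap (λ ν → scale (cf ν) (Dν ν f)) (partitionsUpTo (deg f))

  -- symmetric shift E^a: p(y₁,y₂,…) ↦ p(a,y₁,y₂,…); on monomials
  -- m_λ(a,y) = m_λ(y) + Σ_{i distinct part of λ} a^i m_{λ∖i}(y)
  E : Carrier → Λ → Λ
  E a = concatMap term
    where
    term : Carrier × Partition → Λ
    term (k , λ′) = (k , λ′) ∷ map (λ i → (k * pow a i , removePart i λ′))
                                   (deduplicate _≟ℕ_ (parts λ′))

{-# OPTIONS --safe #-}
-- Let M ρ μ be the coefficient of m μ in θ (m ρ). Since E a (m ρ) = m ρ + Σ_j a^j m (ρ ∖ j), the sum
-- running over the distinct parts j of ρ, comparing the coefficients of the powers of a (a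
-- polynomial identity in a, hence one coefficientwise in characteristic zero) shows that θ
-- commutes with every E a iff M ρ (μ ∪ j) = M (ρ ∖ j) μ for all ρ, μ, j, read as 0 when j is not a
-- part of ρ. By induction on μ this recursion forces M ρ μ = M (ρ ∖ μ) ∅, and 0 unless μ ⊆ ρ.
-- Since Dν (m ρ) = ν! m (ρ ∖ ν) with ν! = Π νᵢ!, the series Σ_ν c ν Dν has exactly such a matrix,
-- with M ν ∅ = c ν ν!. So the operators commuting with all E a are the series with
-- c ν = M ν ∅ / ν!.
module Submission where

open import Defs
open import Level using (Level)
open import Algebra.Bundles using (CommutativeRing)
open import Data.Bool using (true; false; if_then_else_)
open import Data.Nat as ℕ using (ℕ; zero; suc; _≤_; _<_; _∸_; z≤n; s≤s; NonZero; >-nonZero; >-nonZero⁻¹; _!)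
  renaming (_≟_ to _≟ℕ_; _⊔_ to _⊔ℕ_)
open import Data.Nat.Properties as ℕ using (≤-irrelevant; ≤-decTotalOrder; ≤-totalOrder; _!≢0)
open import Data.Nat.ListAction using (sum)
open import Data.Nat.ListAction.Properties using (sum-++; sum-↭)
open import Data.List using (List; []; _∷_; _++_; foldr; map; concatMap; mapMaybe; upTo; applyUpTo;
  length; deduplicate)
open import Data.List.Properties
  using (≡-dec; ++-identityʳ; map-applyUpTo; ++-assoc; ∷-injectiveˡ; ∷-injectiveʳ)
open import Data.List.Membership.Propositional using (_∈_; _∉_)
open import Data.List.Membership.Propositional.Properties
  using (∈-upTo⁺; ∈-applyUpTo⁺; ∈-deduplicate⁻; ∈-deduplicate⁺)
open import Data.List.Relation.Unary.Any using (here; there; any?)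
open import Data.List.Relation.Unary.All using (all?)
open import Data.List.Relation.Unary.Linked using (linked?)
import Data.List.Relation.Unary.All as All
import Data.List.Relation.Unary.Linked as Linked
import Data.List.Relation.Unary.AllPairs as AllPairs
open import Data.List.Relation.Unary.Unique.Propositional using (Unique)
open import Data.List.Relation.Unary.Unique.Propositional.Properties using (upTo⁺; applyUpTo⁺₁)
open import Data.List.Relation.Unary.Unique.DecPropositional.Properties _≟ℕ_ using (deduplicate-!)
open import Data.List.Relation.Binary.Equality.Propositional using (≋⇒≡)
open import Data.List.Relation.Binary.Permutation.Propositional
  using (_↭_; ↭-refl; ↭-reflexive; ↭-sym; ↭-trans; prep; swap; ↭⇒↭ₛ; module PermutationReasoning)
open import Data.List.Relation.Binary.Permutation.Propositional.Properties
  using (shift; drop-∷; ++-comm; ∈-resp-↭; ++⁺ˡ; ++⁺ʳ; All-resp-↭)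
open import Data.List.Relation.Unary.Sorted.TotalOrder.Properties using (↗↭↗⇒≋)
import Relation.Binary.Construct.Flip.EqAndOrd as Flip
open import Data.List.Sort.InsertionSort.Base (Flip.decTotalOrder ≤-decTotalOrder) using (insert)
open import Data.List.Sort.InsertionSort.Properties (Flip.decTotalOrder ≤-decTotalOrder)
  using (insert-↭; insert-↗)
open import Data.Maybe using (Maybe; just; nothing; _>>=_; maybe′)
open import Data.Maybe.Properties using (just-injective)
open import Data.Product using (Σ; _,_; proj₁; proj₂)
open import Function using (_∘_; id)
open import Function.Bundles using (_⇔_; mk⇔)
open import Relation.Nullary using (¬_; Dec; yes; no; does; contradiction)
open import Relation.Nullary.Decidable using (map′; dec-true; dec-false)
open import Relation.Binary.Definitions using (DecidableEquality)
open import Relation.Binary.PropositionalEquality as ≡ using (_≡_; _≢_)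
open import Tactic.RingSolver.Core.AlmostCommutativeRing using (fromCommutativeRing)

partition-≡ : ∀ {ρ σ} → parts ρ ≡ parts σ → ρ ≡ σ
partition-≡ {mkPartition p d q} {mkPartition .p d′ q′} ≡.refl
  rewrite Linked.irrelevant ≤-irrelevant d d′ | All.irrelevant ≤-irrelevant q q′ = ≡.refl

partition-↭ : ∀ {ρ σ} → parts ρ ↭ parts σ → ρ ≡ σ
partition-↭ {ρ} {σ} p =
  partition-≡ (≋⇒≡ (↗↭↗⇒≋ (Flip.totalOrder ≤-totalOrder) (decr ρ) (decr σ) (↭⇒↭ₛ p)))

_≟ᵖ_ : DecidableEquality Partition
ρ ≟ᵖ σ = map′ partition-≡ (≡.cong parts) (≡-dec _≟ℕ_ (parts ρ) (parts σ))

∅ : Partition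
∅ = mkPartition [] Linked.[] All.[]

insertPart : (j : ℕ) .{{_ : NonZero j}} → Partition → Partition
insertPart j μ = mkPartition (insert j (parts μ)) (insert-↗ j (decr μ))
  (All-resp-↭ (↭-sym (insert-↭ j (parts μ))) (>-nonZero⁻¹ j All.∷ pos μ))

insertPart-↭ : ∀ j .{{_ : NonZero j}} μ → parts (insertPart j μ) ↭ j ∷ parts μ
insertPart-↭ j μ = insert-↭ j (parts μ)

removeOne-↭ : ∀ {x xs} → x ∈ xs → xs ↭ x ∷ removeOne x xs
removeOne-↭ {x} {y ∷ ys} x∈ with x ≟ℕ y
removeOne-↭ {x} {y ∷ ys} x∈           | yes ≡.refl = ↭-refl
removeOne-↭ {x} {y ∷ ys} (here x≡y)   | no x≢y     = contradiction x≡y x≢y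
removeOne-↭ {x} {y ∷ ys} (there x∈ys) | no _       =
  ↭-trans (prep y (removeOne-↭ x∈ys)) (swap y x ↭-refl)

part≤size : ∀ {x} ρ → x ∈ parts ρ → x ≤ size ρ
part≤size {x} ρ x∈ρ = ≡.subst (x ≤_) (≡.sym (sum-↭ (removeOne-↭ x∈ρ))) (ℕ.m≤m+n x _)

removePart? : ℕ → Partition → Maybe Partition
removePart? i σ with any? (i ≟ℕ_) (parts σ)
... | yes _ = just (removePart i σ)
... | no  _ = nothing

removePart?-∉ : ∀ {i} ρ → i ∉ parts ρ → removePart? i ρ ≡ nothing
removePart?-∉ {i} ρ i∉ρ with any? (i ≟ℕ_) (parts ρ)
... | yes i∈ρ = contradiction i∈ρ i∉ρ
... | no  _   = ≡.refl

removePart?-∈ : ∀ {i} ρ → i ∈ parts ρ → removePart? i ρ ≡ just (removePart i ρ)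
removePart?-∈ {i} ρ i∈ρ with any? (i ≟ℕ_) (parts ρ)
... | yes _   = ≡.refl
... | no  i∉ρ = contradiction i∈ρ i∉ρ

removePart?-sound : ∀ {i τ σ} → removePart? i τ ≡ just σ → parts τ ↭ i ∷ parts σ
removePart?-sound {i} {τ} eq with any? (i ≟ℕ_) (parts τ)
removePart?-sound {i} {τ} ≡.refl | yes i∈τ = removeOne-↭ i∈τ

removePart?-complete : ∀ {i τ σ} → parts τ ↭ i ∷ parts σ → removePart? i τ ≡ just σ
removePart?-complete {i} {τ} p with any? (i ≟ℕ_) (parts τ)
... | yes i∈τ = ≡.cong just (partition-↭ (drop-∷ (↭-trans (↭-sym (removeOne-↭ i∈τ)) p)))
... | no  i∉τ = contradiction (∈-resp-↭ (↭-sym p) (here ≡.refl)) i∉τ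

-- Removal of the parts xs from ρ, last part first (the order in which Dν
-- applies the derivatives); nothing if xs is not a sub-multiset of ρ.
infixl 5 _∖_
_∖_ : Partition → List ℕ → Maybe Partition
ρ ∖ xs = foldr (λ x m → m >>= removePart? x) (just ρ) xs

∖-sound : ∀ {ρ} xs {σ} → ρ ∖ xs ≡ just σ → xs ++ parts σ ↭ parts ρ
∖-sound [] ≡.refl = ↭-refl
∖-sound {ρ} (x ∷ xs) {σ} eq with ρ ∖ xs in e
... | just τ = begin
  x ∷ xs ++ parts σ   ↭⟨ ↭-sym (shift x xs (parts σ)) ⟩
  xs ++ x ∷ parts σ   ↭⟨ ++⁺ˡ xs (↭-sym (removePart?-sound eq)) ⟩
  xs ++ parts τ       ↭⟨ ∖-sound xs e ⟩
  parts ρ             ∎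
  where open PermutationReasoning

∖-complete : ∀ {ρ} xs {σ} → xs ++ parts σ ↭ parts ρ → ρ ∖ xs ≡ just σ
∖-complete [] p = ≡.cong just (≡.sym (partition-↭ p))
∖-complete {ρ} (x ∷ xs) {σ} p =
  ≡.trans (≡.cong (_>>= removePart? x) (∖-complete {ρ} xs {insertPart x σ} xs++xσ↭ρ))
          (removePart?-complete (insertPart-↭ x σ))
  where
  instance
    x-nonZero : NonZero x
    x-nonZero = >-nonZero (All.lookup (pos ρ) (∈-resp-↭ p (here ≡.refl)))
  xs++xσ↭ρ : xs ++ parts (insertPart x σ) ↭ parts ρ
  xs++xσ↭ρ = begin
    xs ++ parts (insertPart x σ) ↭⟨ ++⁺ˡ xs (insertPart-↭ x σ) ⟩
    xs ++ x ∷ parts σ            ↭⟨ shift x xs (parts σ) ⟩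
    x ∷ xs ++ parts σ            ↭⟨ p ⟩
    parts ρ                      ∎
    where open PermutationReasoning

∖-complement : ∀ {ρ ν σ} → ρ ∖ parts ν ≡ just σ → ρ ∖ parts σ ≡ just ν
∖-complement {ρ} {ν} {σ} e =
  ∖-complete (parts σ) (↭-trans (++-comm (parts σ) (parts ν)) (∖-sound (parts ν) e))

∖-size : ∀ {ρ} xs {σ} → ρ ∖ xs ≡ just σ → size σ ≤ size ρ
∖-size {ρ} xs {σ} e = ≡.subst (size σ ≤_) sum-xsσ≡sum-ρ (ℕ.m≤n+m (size σ) (sum xs))
  where
  sum-xsσ≡sum-ρ : sum xs ℕ.+ size σ ≡ size ρ
  sum-xsσ≡sum-ρ = ≡.trans (≡.sym (sum-++ xs (parts σ))) (sum-↭ (∖-sound xs e))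

∖-self : ∀ ρ → ρ ∖ parts ρ ≡ just ∅
∖-self ρ = ∖-complete (parts ρ) (↭-reflexive (++-identityʳ (parts ρ)))

∖-just-∅ : ∀ {ρ μ} → ρ ∖ parts μ ≡ just ∅ → μ ≡ ρ
∖-just-∅ {ρ} {μ} e =
  partition-↭ (↭-trans (↭-reflexive (≡.sym (++-identityʳ (parts μ)))) (∖-sound (parts μ) e))

just-ext : ∀ {a} {A : Set a} {m n : Maybe A} →
           (∀ x → m ≡ just x → n ≡ just x) → (∀ x → n ≡ just x → m ≡ just x) → m ≡ n
just-ext {m = just x}  m⊆n _   = ≡.sym (m⊆n x ≡.refl)
just-ext {m = nothing} {just y}  _ n⊆m = n⊆m y ≡.refl
just-ext {m = nothing} {nothing} _ _   = ≡.refl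

∖-insertPart : ∀ ρ j .{{_ : NonZero j}} μ →
               ρ ∖ parts (insertPart j μ) ≡ (removePart? j ρ >>= (_∖ parts μ))
∖-insertPart ρ j μ = just-ext to from
  where
  to : ∀ σ → ρ ∖ parts (insertPart j μ) ≡ just σ → (removePart? j ρ >>= (_∖ parts μ)) ≡ just σ
  to σ e = ≡.trans (≡.cong (_>>= (_∖ parts μ)) (removePart?-∈ ρ j∈ρ))
                   (∖-complete (parts μ) (drop-∷ (↭-trans jμσ↭ρ (removeOne-↭ j∈ρ))))
    where
    jμσ↭ρ : j ∷ parts μ ++ parts σ ↭ parts ρ
    jμσ↭ρ = ↭-trans (++⁺ʳ (parts σ) (↭-sym (insertPart-↭ j μ))) (∖-sound _ e)
    j∈ρ : j ∈ parts ρ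
    j∈ρ = ∈-resp-↭ jμσ↭ρ (here ≡.refl)
  from : ∀ σ → (removePart? j ρ >>= (_∖ parts μ)) ≡ just σ → ρ ∖ parts (insertPart j μ) ≡ just σ
  from σ e with removePart? j ρ in r
  ... | just τ = ∖-complete (parts (insertPart j μ)) (begin
    parts (insertPart j μ) ++ parts σ ↭⟨ ++⁺ʳ (parts σ) (insertPart-↭ j μ) ⟩
    j ∷ parts μ ++ parts σ            ↭⟨ prep j (∖-sound (parts μ) e) ⟩
    j ∷ parts τ                       ↭⟨ ↭-sym (removePart?-sound r) ⟩
    parts ρ                           ∎)
    where open PermutationReasoning

length≤size : ∀ ν → length (parts ν) ≤ size ν
length≤size ν = go (pos ν)
  where
  go : ∀ {xs} → All.All (1 ≤_) xs → length xs ≤ sum xs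
  go All.[]          = z≤n
  go (1≤x All.∷ 1≤xs) = ℕ.+-mono-≤ 1≤x (go 1≤xs)

isPartition?-sound : ∀ {l ν} → isPartition? l ≡ just ν → parts ν ≡ l
isPartition?-sound {l} e with linked? (λ x y → y ℕ.≤? x) l | all? (1 ℕ.≤?_) l
isPartition?-sound {l} ≡.refl | yes _ | yes _ = ≡.refl

isPartition?-complete : ∀ ν → isPartition? (parts ν) ≡ just ν
isPartition?-complete ν with linked? (λ x y → y ℕ.≤? x) (parts ν) | all? (1 ℕ.≤?_) (parts ν)
... | yes _ | yes _  = ≡.cong just (partition-≡ ≡.refl)
... | yes _ | no ¬p  = contradiction (pos ν) ¬p
... | no ¬d | _      = contradiction (decr ν) ¬d

module FiniteSums {c ℓ} (R : CommutativeRing c ℓ) where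
  open CommutativeRing R
  open import Relation.Binary.Reasoning.Setoid setoid
  open import Algebra.Properties.CommutativeSemigroup +-commutativeSemigroup using (interchange)
  open import Algebra.Properties.AbelianGroup +-abelianGroup using (⁻¹-∙-comm)

  private variable
    a b : Level
    A : Set a
    B : Set b

  ∑ : (A → Carrier) → List A → Carrier
  ∑ f []       = 0#
  ∑ f (x ∷ xs) = f x + ∑ f xs

  infix 5 ∑
  syntax ∑ (λ x → e) xs = ∑[ x ← xs ] e

  ∑-cong-∈ : ∀ {f g : A → Carrier} xs → (∀ {x} → x ∈ xs → f x ≈ g x) → ∑ f xs ≈ ∑ g xs
  ∑-cong-∈ []       f≈g = refl
  ∑-cong-∈ (x ∷ xs) f≈g = +-cong (f≈g (here ≡.refl)) (∑-cong-∈ xs (f≈g ∘ there))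

  ∑-cong : ∀ {f g : A → Carrier} xs → (∀ x → f x ≈ g x) → ∑ f xs ≈ ∑ g xs
  ∑-cong xs f≈g = ∑-cong-∈ xs (λ {x} _ → f≈g x)

  ∑-zero : ∀ {f : A → Carrier} xs → (∀ {x} → x ∈ xs → f x ≈ 0#) → ∑ f xs ≈ 0#
  ∑-zero []       f≈0 = refl
  ∑-zero (x ∷ xs) f≈0 = trans (+-cong (f≈0 (here ≡.refl)) (∑-zero xs (f≈0 ∘ there))) (+-identityˡ 0#)

  ∑-+ : ∀ (f g : A → Carrier) xs → ∑[ x ← xs ] (f x + g x) ≈ ∑ f xs + ∑ g xs
  ∑-+ f g []       = sym (+-identityˡ 0#)
  ∑-+ f g (x ∷ xs) = trans (+-congˡ (∑-+ f g xs)) (interchange (f x) (g x) _ _)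

  ∑-- : ∀ (f g : A → Carrier) xs → ∑[ x ← xs ] (f x - g x) ≈ ∑ f xs - ∑ g xs
  ∑-- f g []       = sym (-‿inverseʳ 0#)
  ∑-- f g (x ∷ xs) =
    trans (+-congˡ (∑-- f g xs)) (trans (interchange (f x) (- g x) _ _) (+-congˡ (⁻¹-∙-comm (g x) _)))

  ∑-*ˡ : ∀ k (f : A → Carrier) xs → ∑[ x ← xs ] (k * f x) ≈ k * ∑ f xs
  ∑-*ˡ k f []       = sym (zeroʳ k)
  ∑-*ˡ k f (x ∷ xs) = trans (+-congˡ (∑-*ˡ k f xs)) (sym (distribˡ k (f x) _))

  ∑-++ : ∀ (f : A → Carrier) xs ys → ∑ f (xs ++ ys) ≈ ∑ f xs + ∑ f ys
  ∑-++ f []       ys = sym (+-identityˡ _)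
  ∑-++ f (x ∷ xs) ys = trans (+-congˡ (∑-++ f xs ys)) (sym (+-assoc (f x) _ _))

  ∑-map : ∀ (f : B → Carrier) (g : A → B) xs → ∑ f (map g xs) ≡ ∑ (f ∘ g) xs
  ∑-map f g []       = ≡.refl
  ∑-map f g (x ∷ xs) = ≡.cong (f (g x) +_) (∑-map f g xs)

  ∑-concatMap : ∀ (f : B → Carrier) (g : A → List B) xs → ∑ f (concatMap g xs) ≈ ∑[ x ← xs ] ∑ f (g x)
  ∑-concatMap f g []       = refl
  ∑-concatMap f g (x ∷ xs) = trans (∑-++ f (g x) _) (+-congˡ (∑-concatMap f g xs))

  ∑-mapMaybe : ∀ (f : B → Carrier) (g : A → Maybe B) xs →
               ∑ f (mapMaybe g xs) ≈ ∑[ x ← xs ] maybe′ f 0# (g x)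
  ∑-mapMaybe f g []       = refl
  ∑-mapMaybe f g (x ∷ xs) with g x
  ... | just y  = +-congˡ (∑-mapMaybe f g xs)
  ... | nothing = trans (∑-mapMaybe f g xs) (sym (+-identityˡ _))

  ∑-swap : ∀ (F : A → B → Carrier) xs ys →
           ∑[ x ← xs ] ∑[ y ← ys ] F x y ≈ ∑[ y ← ys ] ∑[ x ← xs ] F x y
  ∑-swap F []       ys = sym (∑-zero ys (λ _ → refl))
  ∑-swap F (x ∷ xs) ys = trans (+-congˡ (∑-swap F xs ys)) (sym (∑-+ (F x) _ ys))

  ∑-single : ∀ {f : A → Carrier} {x} xs → Unique xs → x ∈ xs → (∀ y → y ≢ x → f y ≈ 0#) → ∑ f xs ≈ f x
  ∑-single (x ∷ xs) (x∉xs AllPairs.∷ _) (here ≡.refl) f≈0 =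
    trans (+-congˡ (∑-zero xs (λ y∈xs → f≈0 _ (λ { ≡.refl → All.lookup x∉xs y∈xs ≡.refl }))))
          (+-identityʳ _)
  ∑-single (y ∷ xs) (y∉xs AllPairs.∷ u) (there x∈xs) f≈0 =
    trans (+-cong (f≈0 y (λ { ≡.refl → All.lookup y∉xs x∈xs ≡.refl })) (∑-single xs u x∈xs f≈0))
          (+-identityˡ _)

  ∑-upTo-single : ∀ {f : ℕ → Carrier} {i n} → i < n → (∀ j → j ≢ i → f j ≈ 0#) → ∑ f (upTo n) ≈ f i
  ∑-upTo-single {n = n} i<n = ∑-single (upTo n) (upTo⁺ n) (∈-upTo⁺ i<n)

  ∑-applyUpTo-suc : ∀ (f : ℕ → Carrier) n → ∑ f (applyUpTo suc n) ≡ ∑[ i ← upTo n ] f (suc i)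
  ∑-applyUpTo-suc f n = ≡.trans (≡.cong (∑ f) (≡.sym (map-applyUpTo id suc n))) (∑-map f suc (upTo n))

  if-true : ∀ {p} {P : Set p} (d : Dec P) → P → ∀ x → (if does d then x else 0#) ≈ x
  if-true d p x rewrite dec-true d p = refl

  if-false : ∀ {p} {P : Set p} (d : Dec P) → ¬ P → ∀ x → (if does d then x else 0#) ≈ 0#
  if-false d ¬p x rewrite dec-false d ¬p = refl

  -- Double counting: both sides equal ∑[ x ← xs ] ∑[ y ← ys ] [ y = x ] G y.
  ∑-⊆ : (_≟_ : DecidableEquality A) {G : A → Carrier} (xs ys : List A) → Unique xs → Unique ys →
        (∀ {x} → x ∈ xs → x ∈ ys) → (∀ {y} → y ∈ ys → y ∉ xs → G y ≈ 0#) → ∑ G xs ≈ ∑ G ys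
  ∑-⊆ {A = A} _≟_ {G} xs ys xs! ys! xs⊆ys G≈0 = begin
    ∑[ x ← xs ] G x                  ≈⟨ ∑-cong-∈ xs (sym ∘ pick-ys) ⟩
    ∑[ x ← xs ] ∑[ y ← ys ] pick x y ≈⟨ ∑-swap pick xs ys ⟩
    ∑[ y ← ys ] ∑[ x ← xs ] pick x y ≈⟨ ∑-cong-∈ ys pick-xs ⟩
    ∑[ y ← ys ] G y                  ∎
    where
    pick : A → A → Carrier
    pick x y = if does (y ≟ x) then G y else 0#
    pick-ys : ∀ {x} → x ∈ xs → ∑[ y ← ys ] pick x y ≈ G x
    pick-ys {x} x∈xs =
      trans (∑-single ys ys! (xs⊆ys x∈xs) (λ y y≢x → if-false (y ≟ x) y≢x (G y)))
            (if-true (x ≟ x) ≡.refl (G x))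
    pick-xs : ∀ {y} → y ∈ ys → ∑[ x ← xs ] pick x y ≈ G y
    pick-xs {y} y∈ys with any? (y ≟_) xs
    ... | yes y∈xs = trans (∑-single xs xs! y∈xs (λ x x≢y → if-false (y ≟ x) (x≢y ∘ ≡.sym) (G y)))
                           (if-true (y ≟ y) ≡.refl (G y))
    ... | no  y∉xs = trans (∑-zero xs (λ x∈xs → if-false (y ≟ _) (λ { ≡.refl → y∉xs x∈xs }) (G y)))
                           (sym (G≈0 y∈ys y∉xs))

  ∑-compositions : ∀ fuel n (G : List ℕ → Carrier) →
    ∑ G (compositions (suc fuel) n) ≈
    G [] + (∑[ k ← upTo n ] ∑[ q ← compositions fuel (n ∸ suc k) ] G (suc k ∷ q))
  ∑-compositions fuel n G = +-congˡ (trans (∑-concatMap G (λ k → map (suc k ∷_) (qs k)) (upTo n))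
                                           (∑-cong (upTo n) (λ k → reflexive (∑-map G (suc k ∷_) (qs k)))))
    where qs = λ k → compositions fuel (n ∸ suc k)

  ∑-compositions-single : ∀ fuel n {G : List ℕ → Carrier} p →
    All.All (1 ≤_) p → sum p ≤ n → length p ≤ fuel → (∀ q → q ≢ p → G q ≈ 0#) →
    ∑ G (compositions fuel n) ≈ G p
  ∑-compositions-single zero       n []       _ _ _  _ = +-identityʳ _
  ∑-compositions-single zero       n (_ ∷ _)  _ _ () _
  ∑-compositions-single (suc fuel) n {G} [] _ _ _ G≈0 = begin
    ∑ G (compositions (suc fuel) n)
      ≈⟨ ∑-compositions fuel n G ⟩
    G [] + (∑[ k ← upTo n ] ∑[ q ← compositions fuel (n ∸ suc k) ] G (suc k ∷ q))
      ≈⟨ +-congˡ (∑-zero (upTo n) λ {k} _ →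
           ∑-zero (compositions fuel (n ∸ suc k)) λ {q} _ → G≈0 (suc k ∷ q) λ ()) ⟩
    G [] + 0#
      ≈⟨ +-identityʳ _ ⟩
    G [] ∎
  ∑-compositions-single (suc fuel) n (zero ∷ _) (() All.∷ _) _ _ _
  ∑-compositions-single (suc fuel) n {G} (suc x ∷ xs) (_ All.∷ xs>0) Σp≤n (s≤s |xs|≤fuel) G≈0 = begin
    ∑ G (compositions (suc fuel) n)
      ≈⟨ ∑-compositions fuel n G ⟩
    G [] + (∑[ k ← upTo n ] ∑[ q ← compositions fuel (n ∸ suc k) ] G (suc k ∷ q))
      ≈⟨ +-cong (G≈0 [] λ ()) (∑-upTo-single x<n other-blocks≈0) ⟩
    0# + (∑[ q ← compositions fuel (n ∸ suc x) ] G (suc x ∷ q))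
      ≈⟨ +-identityˡ _ ⟩
    ∑[ q ← compositions fuel (n ∸ suc x) ] G (suc x ∷ q)
      ≈⟨ ∑-compositions-single fuel (n ∸ suc x) xs xs>0 Σxs≤n∸x |xs|≤fuel
           (λ q q≢xs → G≈0 (suc x ∷ q) (q≢xs ∘ ∷-injectiveʳ)) ⟩
    G (suc x ∷ xs) ∎
    where
    x<n : x < n
    x<n = ℕ.≤-trans (ℕ.m≤m+n (suc x) (sum xs)) Σp≤n
    Σxs≤n∸x : sum xs ≤ n ∸ suc x
    Σxs≤n∸x = ≡.subst (_≤ n ∸ suc x) (ℕ.m+n∸m≡n (suc x) (sum xs)) (ℕ.∸-monoˡ-≤ (suc x) Σp≤n)
    other-blocks≈0 : ∀ k → k ≢ x → ∑[ q ← compositions fuel (n ∸ suc k) ] G (suc k ∷ q) ≈ 0#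
    other-blocks≈0 k k≢x = ∑-zero (compositions fuel (n ∸ suc k)) λ {q} _ →
      G≈0 (suc k ∷ q) (k≢x ∘ ℕ.suc-injective ∘ ∷-injectiveˡ)

module Polynomials {c ℓ} (K : CharZeroField c ℓ) where
  open CharZeroField K hiding (zero)
  open Sym K using (fromℕ; pow)
  open FiniteSums commRing
  open import Algebra.Properties.Ring ring using (x[y-z]≈xy-xz)
  open import Algebra.Properties.Group +-group using (//-rightDividesˡ; x∙y⁻¹≈ε⇒x≈y; x≈y⇒x∙y⁻¹≈ε; ∙-cancelˡ)
  open import Relation.Binary.Reasoning.Setoid setoid

  cancelˡ : ∀ {z q} → ¬ z ≈ 0# → z * q ≈ 0# → q ≈ 0#
  cancelˡ {z} {q} z≉0 zq≈0 with inverse z z≉0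
  ... | z⁻¹ , zz⁻¹≈1 = begin
    q              ≈⟨ sym (*-identityˡ q) ⟩
    1# * q         ≈⟨ *-congʳ (sym zz⁻¹≈1) ⟩
    (z * z⁻¹) * q  ≈⟨ *-congʳ (*-comm z z⁻¹) ⟩
    (z⁻¹ * z) * q  ≈⟨ *-assoc z⁻¹ z q ⟩
    z⁻¹ * (z * q)  ≈⟨ *-congˡ zq≈0 ⟩
    z⁻¹ * 0#       ≈⟨ zeroʳ z⁻¹ ⟩
    0#             ∎

  fromℕ-injective : ∀ {k l} → fromℕ k ≈ fromℕ l → k ≡ l
  fromℕ-injective {zero}  {zero}  _ = ≡.refl
  fromℕ-injective {zero}  {suc l} e = contradiction (sym e) (charZero l)
  fromℕ-injective {suc k} {zero}  e = contradiction e (charZero k)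
  fromℕ-injective {suc k} {suc l} e = ≡.cong suc (fromℕ-injective (∙-cancelˡ 1# _ _ e))

  horner : ℕ → (ℕ → Carrier) → Carrier → Carrier
  horner zero    X x = 0#
  horner (suc n) X x = X 0 + x * horner n (X ∘ suc) x

  -- The coefficients of the quotient of c + x * horner n Z x by x - r; they do not depend on c.
  quotient : Carrier → ℕ → (ℕ → Carrier) → ℕ → Carrier
  quotient r zero    Z i       = 0#
  quotient r (suc n) Z zero    = horner (suc n) Z r
  quotient r (suc n) Z (suc i) = quotient r n (Z ∘ suc) i

  private
    -- Stated with x = (x - r) + r, because the ring solver cannot cancel
    -- r * e - r * e without a decision procedure for 0#.
    divide-step : ∀ c x r e d → c + x * (e + (x - r) * d) ≈ (c + r * e) + (x - r) * (e + x * d)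
    divide-step c x r e d = begin
      c + x * (e + δ * d)                 ≈⟨ +-congˡ (*-congʳ (sym δ+r≈x)) ⟩
      c + (δ + r) * (e + δ * d)           ≈⟨ identity c r δ e d ⟩
      (c + r * e) + δ * (e + (δ + r) * d) ≈⟨ +-congˡ (*-congˡ (+-congˡ (*-congʳ δ+r≈x))) ⟩
      (c + r * e) + δ * (e + x * d)       ∎
      where
      δ = x - r
      δ+r≈x : δ + r ≈ x
      δ+r≈x = //-rightDividesˡ r x
      open import Tactic.RingSolver.NonReflective (fromCommutativeRing commRing (λ _ → nothing))
      identity : ∀ c r δ e d → c + (δ + r) * (e + δ * d) ≈ (c + r * e) + δ * (e + (δ + r) * d)
      identity = solve 5 (λ c r δ e d → (c ⊕ (δ ⊕ r) ⊗ (e ⊕ δ ⊗ d))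
                                     ⊜ ((c ⊕ r ⊗ e) ⊕ δ ⊗ (e ⊕ (δ ⊕ r) ⊗ d))) refl

  horner-divide : ∀ n X x r →
    horner (suc n) X x ≈ horner (suc n) X r + (x - r) * horner n (quotient r n (X ∘ suc)) x
  horner-divide zero    X x r = begin
    X 0 + x * 0#                  ≈⟨ +-congˡ (zeroʳ x) ⟩
    X 0 + 0#                      ≈⟨ +-cong (sym (trans (+-congˡ (zeroʳ r)) (+-identityʳ _)))
                                             (sym (zeroʳ _)) ⟩
    (X 0 + r * 0#) + (x - r) * 0# ∎
  horner-divide (suc n) X x r = begin
    X 0 + x * horner (suc n) (X ∘ suc) x
      ≈⟨ +-congˡ (*-congˡ (horner-divide n (X ∘ suc) x r)) ⟩
    X 0 + x * (horner (suc n) (X ∘ suc) r + (x - r) * horner n (quotient r n (X ∘ suc ∘ suc)) x)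
      ≈⟨ divide-step (X 0) x r _ _ ⟩
    (X 0 + r * horner (suc n) (X ∘ suc) r) + (x - r) * horner (suc n) (quotient r (suc n) (X ∘ suc)) x ∎

  horner-zero : ∀ n {X} → (∀ i → i < n → X i ≈ 0#) → ∀ x → horner n X x ≈ 0#
  horner-zero zero    X≈0 x = refl
  horner-zero (suc n) {X} X≈0 x = begin
    X 0 + x * horner n (X ∘ suc) x
      ≈⟨ +-cong (X≈0 0 (s≤s z≤n)) (*-congˡ (horner-zero n (λ i → X≈0 (suc i) ∘ s≤s) x)) ⟩
    0# + x * 0#
      ≈⟨ trans (+-identityˡ _) (zeroʳ x) ⟩
    0# ∎

  constant-zero : ∀ n {X r} → horner (suc n) X r ≈ 0# → (∀ i → i < n → X (suc i) ≈ 0#) → X 0 ≈ 0#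
  constant-zero n {X} {r} p≈0 X′≈0 = begin
    X 0                            ≈⟨ sym (+-identityʳ _) ⟩
    X 0 + 0#                       ≈⟨ +-congˡ (sym (trans (*-congˡ (horner-zero n X′≈0 r)) (zeroʳ r))) ⟩
    X 0 + r * horner n (X ∘ suc) r ≈⟨ p≈0 ⟩
    0#                             ∎

  quotient-zero : ∀ n {Z} r → (∀ i → i < n → quotient r n Z i ≈ 0#) → ∀ i → i < n → Z i ≈ 0#
  quotient-zero (suc n) {Z} r Q≈0 zero    _         = constant-zero n {Z} (Q≈0 0 (s≤s z≤n)) Z′≈0
    where Z′≈0 = quotient-zero n r (λ i → Q≈0 (suc i) ∘ s≤s)
  quotient-zero (suc n)     r Q≈0 (suc i) (s≤s i<n) = quotient-zero n r (λ i → Q≈0 (suc i) ∘ s≤s) i i<n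

  -- Dividing by x - s 0 leaves a polynomial vanishing at s 1, s 2, …
  horner-vanishing : ∀ n {X} (s : ℕ → Carrier) → (∀ {k l} → s k ≈ s l → k ≡ l) →
                     (∀ k → horner n X (s k) ≈ 0#) → ∀ i → i < n → X i ≈ 0#
  horner-vanishing (suc n) {X} s s-injective p≈0 = λ
    { zero    _         → constant-zero n {X} (p≈0 0) X′≈0
    ; (suc i) (s≤s i<n) → X′≈0 i i<n }
    where
    Q = quotient (s 0) n (X ∘ suc)
    Q≈0 : ∀ k → horner n Q (s (suc k)) ≈ 0#
    Q≈0 k = cancelˡ (λ d≈0 → contradiction (s-injective (x∙y⁻¹≈ε⇒x≈y _ _ d≈0)) λ ()) (begin
      (s (suc k) - s 0) * horner n Q (s (suc k))
        ≈⟨ sym (+-identityˡ _) ⟩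
      0# + (s (suc k) - s 0) * horner n Q (s (suc k))
        ≈⟨ +-congʳ (sym (p≈0 0)) ⟩
      horner (suc n) X (s 0) + (s (suc k) - s 0) * horner n Q (s (suc k))
        ≈⟨ sym (horner-divide n X (s (suc k)) (s 0)) ⟩
      horner (suc n) X (s (suc k))
        ≈⟨ p≈0 (suc k) ⟩
      0# ∎)
    X′≈0 : ∀ i → i < n → X (suc i) ≈ 0#
    X′≈0 = quotient-zero n (s 0) (horner-vanishing n (s ∘ suc) (ℕ.suc-injective ∘ s-injective) Q≈0)

  ∑-pow≈horner : ∀ n X a → ∑[ i ← upTo n ] pow a (suc i) * X i ≈ a * horner n X a
  ∑-pow≈horner zero    X a = sym (zeroʳ a)
  ∑-pow≈horner (suc n) X a = begin
    (a * 1#) * X 0 + (∑[ j ← applyUpTo suc n ] pow a (suc j) * X j)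
      ≈⟨ +-cong (*-congʳ (*-identityʳ a)) (reflexive (∑-applyUpTo-suc _ n)) ⟩
    a * X 0 + (∑[ i ← upTo n ] (a * pow a (suc i)) * X (suc i))
      ≈⟨ +-congˡ (trans (∑-cong (upTo n) (λ i → *-assoc a _ _)) (∑-*ˡ a _ (upTo n))) ⟩
    a * X 0 + a * (∑[ i ← upTo n ] pow a (suc i) * X (suc i))
      ≈⟨ +-congˡ (*-congˡ (∑-pow≈horner n (X ∘ suc) a)) ⟩
    a * X 0 + a * (a * horner n (X ∘ suc) a)
      ≈⟨ sym (distribˡ a _ _) ⟩
    a * horner (suc n) X a ∎

  coefficients-unique : ∀ n (X Y : ℕ → Carrier) →
    (∀ a → ∑[ i ← upTo n ] pow a (suc i) * X i ≈ ∑[ i ← upTo n ] pow a (suc i) * Y i) →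
    ∀ i → i < n → X i ≈ Y i
  coefficients-unique n X Y X≈Y i i<n =
    x∙y⁻¹≈ε⇒x≈y _ _
      (horner-vanishing n (fromℕ ∘ suc) (ℕ.suc-injective ∘ fromℕ-injective) difference≈0 i i<n)
    where
    difference≈0 : ∀ k → horner n (λ i → X i - Y i) (fromℕ (suc k)) ≈ 0#
    difference≈0 k = cancelˡ (charZero k) (begin
      a * horner n (λ i → X i - Y i) a
        ≈⟨ sym (∑-pow≈horner n _ a) ⟩
      ∑[ i ← upTo n ] pow a (suc i) * (X i - Y i)
        ≈⟨ ∑-cong (upTo n) (λ i → x[y-z]≈xy-xz _ _ _) ⟩
      ∑[ i ← upTo n ] (pow a (suc i) * X i - pow a (suc i) * Y i)
        ≈⟨ ∑-- _ _ (upTo n) ⟩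
      (∑[ i ← upTo n ] pow a (suc i) * X i) - (∑[ i ← upTo n ] pow a (suc i) * Y i)
        ≈⟨ x≈y⇒x∙y⁻¹≈ε (X≈Y a) ⟩
      0# ∎)
      where a = fromℕ (suc k)

module SymmetricFunctions {c ℓ} (K : CharZeroField c ℓ) where
  open CharZeroField K hiding (zero)
  open Sym K
  open FiniteSums commRing
  open Polynomials K using (cancelˡ; coefficients-unique)
  open import Algebra.Properties.CommutativeSemigroup *-commutativeSemigroup using (x∙yz≈y∙xz)
  open import Algebra.Properties.Group +-group using (∙-cancelˡ)
  open import Relation.Binary.Reasoning.Setoid setoid

  δ : Partition → Partition → Carrier
  δ σ μ = if does (σ ≟ᵖ μ) then 1# else 0#

  δ-diag : ∀ μ → δ μ μ ≈ 1#
  δ-diag μ = if-true (μ ≟ᵖ μ) ≡.refl 1#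

  δ-miss : ∀ {μ} m → m ≢ just μ → maybe′ (λ σ → δ σ μ) 0# m ≈ 0#
  δ-miss nothing  _  = refl
  δ-miss (just σ) m≢ = if-false (σ ≟ᵖ _) (m≢ ∘ ≡.cong just) 1#

  ⟪_∣_⟫ : (Partition → Carrier) → Λ → Carrier
  ⟪ w ∣ f ⟫ = ∑[ t ← f ] proj₁ t * w (proj₂ t)

  ⟪∣⟫-m : ∀ w ρ → ⟪ w ∣ m ρ ⟫ ≈ w ρ
  ⟪∣⟫-m w ρ = trans (+-identityʳ _) (*-identityˡ _)

  ⟪∣⟫-cong : ∀ {w w′} f → (∀ ρ → w ρ ≈ w′ ρ) → ⟪ w ∣ f ⟫ ≈ ⟪ w′ ∣ f ⟫
  ⟪∣⟫-cong f w≈w′ = ∑-cong f (λ t → *-congˡ (w≈w′ (proj₂ t)))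

  ⟪∣⟫-cong-deg : ∀ {w w′} N f → deg f ≤ N → (∀ ρ → size ρ ≤ N → w ρ ≈ w′ ρ) → ⟪ w ∣ f ⟫ ≈ ⟪ w′ ∣ f ⟫
  ⟪∣⟫-cong-deg N []            _     _     = refl
  ⟪∣⟫-cong-deg N ((k , ρ) ∷ f) deg≤N w≈w′ =
    +-cong (*-congˡ (w≈w′ ρ (ℕ.m⊔n≤o⇒m≤o (size ρ) (deg f) deg≤N)))
           (⟪∣⟫-cong-deg N f (ℕ.m⊔n≤o⇒n≤o (size ρ) (deg f) deg≤N) w≈w′)

  ⟪∣⟫-++ : ∀ w f g → ⟪ w ∣ f ++ g ⟫ ≈ ⟪ w ∣ f ⟫ + ⟪ w ∣ g ⟫
  ⟪∣⟫-++ w = ∑-++ _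

  ⟪∣⟫-scale : ∀ w k f → ⟪ w ∣ scale k f ⟫ ≈ k * ⟪ w ∣ f ⟫
  ⟪∣⟫-scale w k f = trans (reflexive (∑-map _ _ f)) (trans (∑-cong f (λ t → *-assoc k _ _)) (∑-*ˡ k _ f))

  ⟪∣⟫-+ : ∀ w w′ f → ⟪ (λ ρ → w ρ + w′ ρ) ∣ f ⟫ ≈ ⟪ w ∣ f ⟫ + ⟪ w′ ∣ f ⟫
  ⟪∣⟫-+ w w′ f = trans (∑-cong f (λ t → distribˡ (proj₁ t) _ _)) (∑-+ _ _ f)

  ⟪∣⟫-∑ : ∀ {a} {A : Set a} (x : A → Carrier) (W : A → Partition → Carrier) is f →
          ⟪ (λ ρ → ∑[ i ← is ] x i * W i ρ) ∣ f ⟫ ≈ ∑[ i ← is ] x i * ⟪ W i ∣ f ⟫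
  ⟪∣⟫-∑ x W is f = begin
    ∑[ t ← f ] proj₁ t * (∑[ i ← is ] x i * W i (proj₂ t))
      ≈⟨ ∑-cong f (λ t → sym (∑-*ˡ (proj₁ t) _ is)) ⟩
    ∑[ t ← f ] ∑[ i ← is ] proj₁ t * (x i * W i (proj₂ t))
      ≈⟨ ∑-swap _ f is ⟩
    ∑[ i ← is ] ∑[ t ← f ] proj₁ t * (x i * W i (proj₂ t))
      ≈⟨ ∑-cong is (λ i → trans (∑-cong f (λ t → x∙yz≈y∙xz _ _ _)) (∑-*ˡ (x i) _ f)) ⟩
    ∑[ i ← is ] x i * ⟪ W i ∣ f ⟫ ∎

  coeff≈⟪δ⟫ : ∀ f μ → coeff f μ ≈ ⟪ (λ σ → δ σ μ) ∣ f ⟫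
  coeff≈⟪δ⟫ []            μ = refl
  coeff≈⟪δ⟫ ((k , σ) ∷ f) μ = +-cong (indicator (does (σ ≟ᵖ μ))) (coeff≈⟪δ⟫ f μ)
    where
    indicator : ∀ b → (if b then k else 0#) ≈ k * (if b then 1# else 0#)
    indicator true  = sym (*-identityʳ k)
    indicator false = sym (zeroʳ k)

  coeff-++ : ∀ f g μ → coeff (f ++ g) μ ≈ coeff f μ + coeff g μ
  coeff-++ f g μ =
    trans (coeff≈⟪δ⟫ (f ++ g) μ) (trans (⟪∣⟫-++ _ f g) (sym (+-cong (coeff≈⟪δ⟫ f μ) (coeff≈⟪δ⟫ g μ))))

  coeff-scale : ∀ k f μ → coeff (scale k f) μ ≈ k * coeff f μ
  coeff-scale k f μ =
    trans (coeff≈⟪δ⟫ (scale k f) μ) (trans (⟪∣⟫-scale _ k f) (*-congˡ (sym (coeff≈⟪δ⟫ f μ))))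

  matrix : LinOp → Partition → Partition → Carrier
  matrix θ ρ μ = coeff (fun θ (m ρ)) μ

  coeff-fun : ∀ θ f μ → coeff (fun θ f) μ ≈ ⟪ (λ ρ → matrix θ ρ μ) ∣ f ⟫
  coeff-fun θ [] μ = begin
    coeff (fun θ []) μ            ≈⟨ homog θ 0# [] μ ⟩
    coeff (scale 0# (fun θ [])) μ ≈⟨ coeff-scale 0# (fun θ []) μ ⟩
    0# * coeff (fun θ []) μ       ≈⟨ zeroˡ _ ⟩
    0#                            ∎
  coeff-fun θ ((k , ρ) ∷ f) μ = begin
    coeff (fun θ ((k , ρ) ∷ f)) μ                      ≈⟨ additive θ ((k , ρ) ∷ []) f μ ⟩
    coeff (fun θ ((k , ρ) ∷ []) ++ fun θ f) μ          ≈⟨ coeff-++ (fun θ ((k , ρ) ∷ [])) (fun θ f) μ ⟩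
    coeff (fun θ ((k , ρ) ∷ [])) μ + coeff (fun θ f) μ ≈⟨ +-cong monomial-term (coeff-fun θ f μ) ⟩
    k * matrix θ ρ μ + ⟪ (λ ρ → matrix θ ρ μ) ∣ f ⟫    ∎
    where
    k·mρ : ((k , ρ) ∷ []) ≈Λ scale k (m ρ)
    k·mρ ν = trans (coeff≈⟪δ⟫ ((k , ρ) ∷ []) ν)
      (trans (+-congʳ (*-congʳ (sym (*-identityʳ k)))) (sym (coeff≈⟪δ⟫ (scale k (m ρ)) ν)))
    monomial-term : coeff (fun θ ((k , ρ) ∷ [])) μ ≈ k * matrix θ ρ μ
    monomial-term = trans (fun-cong θ k·mρ μ) (trans (homog θ k (m ρ) μ) (coeff-scale k (fun θ (m ρ)) μ))

  -- The matrix of the series Σ (c ν / ν!) Dν: m ρ ↦ Σ_μ c (ρ ∖ μ) m μ.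
  removalMatrix : (Partition → Carrier) → Partition → Partition → Carrier
  removalMatrix c ρ μ = maybe′ c 0# (ρ ∖ parts μ)

  maybe′-cong : ∀ {f g : Partition → Carrier} m → (∀ σ → f σ ≈ g σ) → maybe′ f 0# m ≈ maybe′ g 0# m
  maybe′-cong (just σ) f≈g = f≈g σ
  maybe′-cong nothing  _   = refl

  δ≈removalMatrix : ∀ ρ μ → δ ρ μ ≈ removalMatrix (λ σ → δ σ ∅) ρ μ
  δ≈removalMatrix ρ μ with ρ ≟ᵖ μ
  ... | yes ≡.refl = trans (δ-diag ρ) (reflexive (≡.cong (maybe′ (λ σ → δ σ ∅) 0#) (≡.sym (∖-self ρ))))
  ... | no  ρ≢μ    = trans (if-false (ρ ≟ᵖ μ) ρ≢μ 1#) (sym (δ-miss (ρ ∖ parts μ) (ρ≢μ ∘ ≡.sym ∘ ∖-just-∅)))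

  -- The coefficientwise form of E a ∘ θ = θ ∘ E a, where M ρ μ is the coefficient of m μ in θ (m ρ).
  ShiftRecursive : (Partition → Partition → Carrier) → Set ℓ
  ShiftRecursive M = ∀ ρ μ i → M ρ (insertPart (suc i) μ) ≈ maybe′ (λ τ → M τ μ) 0# (removePart? (suc i) ρ)

  ShiftRecursive-resp : ∀ {M M′} → (∀ ρ μ → M ρ μ ≈ M′ ρ μ) → ShiftRecursive M → ShiftRecursive M′
  ShiftRecursive-resp M≈M′ rec ρ μ i =
    trans (sym (M≈M′ ρ _)) (trans (rec ρ μ i) (maybe′-cong (removePart? (suc i) ρ) (λ τ → M≈M′ τ μ)))

  removalMatrix-recursive : ∀ c → ShiftRecursive (removalMatrix c)
  removalMatrix-recursive c ρ μ i =
    reflexive (≡.trans (≡.cong (maybe′ c 0#) (∖-insertPart ρ (suc i) μ))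
                       (maybe′->>= (removePart? (suc i) ρ)))
    where
    maybe′->>= : ∀ m → maybe′ c 0# (m >>= (_∖ parts μ)) ≡ maybe′ (λ τ → maybe′ c 0# (τ ∖ parts μ)) 0# m
    maybe′->>= (just τ) = ≡.refl
    maybe′->>= nothing  = ≡.refl

  recursive⇒removalMatrix : ∀ {M} → ShiftRecursive M → ∀ ρ μ → M ρ μ ≈ removalMatrix (λ ν → M ν ∅) ρ μ
  recursive⇒removalMatrix {M} rec ρ (mkPartition xs d p) = go xs d p ρ
    where
    W = removalMatrix (λ ν → M ν ∅)
    go : ∀ xs d p ρ → M ρ (mkPartition xs d p) ≈ W ρ (mkPartition xs d p)
    go []           Linked.[] All.[]           ρ = refl
    go (suc x ∷ xs) d         (s≤s z≤n All.∷ p) ρ = begin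
      M ρ μ                                ≡⟨ ≡.cong (M ρ) μ≡x∷μ′ ⟩
      M ρ (insertPart (suc x) μ′)          ≈⟨ rec ρ μ′ x ⟩
      maybe′ (λ τ → M τ μ′) 0# ρ∖x         ≈⟨ maybe′-cong ρ∖x (go xs (Linked.tail d) p) ⟩
      maybe′ (λ τ → W τ μ′) 0# ρ∖x         ≈⟨ sym (removalMatrix-recursive _ ρ μ′ x) ⟩
      W ρ (insertPart (suc x) μ′)          ≡⟨ ≡.cong (W ρ) (≡.sym μ≡x∷μ′) ⟩
      W ρ μ                                ∎
      where
      μ  = mkPartition (suc x ∷ xs) d (s≤s z≤n All.∷ p)
      μ′ = mkPartition xs (Linked.tail d) p
      ρ∖x = removePart? (suc x) ρ
      μ≡x∷μ′ : μ ≡ insertPart (suc x) μ′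
      μ≡x∷μ′ = partition-↭ (↭-sym (insertPart-↭ (suc x) μ′))

  -- The transpose of E a on weights, truncated to parts ≤ N.
  shiftᵀ : ℕ → Carrier → (Partition → Carrier) → Partition → Carrier
  shiftᵀ N a w ρ = w ρ + (∑[ i ← upTo N ] pow a (suc i) * maybe′ w 0# (removePart? (suc i) ρ))

  ⟪∣⟫-removals : ∀ N a w k ρ → size ρ ≤ N →
    ⟪ w ∣ map (λ i → (k * pow a i , removePart i ρ)) (deduplicate _≟ℕ_ (parts ρ)) ⟫ ≈
    k * (∑[ i ← upTo N ] pow a (suc i) * maybe′ w 0# (removePart? (suc i) ρ))
  ⟪∣⟫-removals N a w k ρ size≤N = begin
    ⟪ w ∣ map (λ i → (k * pow a i , removePart i ρ)) L ⟫
      ≡⟨ ∑-map _ _ L ⟩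
    ∑[ i ← L ] (k * pow a i) * w (removePart i ρ)
      ≈⟨ ∑-cong-∈ L (λ i∈L → trans (*-assoc k _ _) (*-congˡ (*-congˡ (removed i∈L)))) ⟩
    ∑[ i ← L ] k * G i
      ≈⟨ ∑-*ˡ k G L ⟩
    k * ∑ G L
      ≈⟨ *-congˡ (∑-⊆ _≟ℕ_ L (applyUpTo suc N) (deduplicate-! (parts ρ)) 1…N-unique L⊆1…N G≈0) ⟩
    k * ∑ G (applyUpTo suc N)
      ≡⟨ ≡.cong (k *_) (∑-applyUpTo-suc G N) ⟩
    k * (∑[ i ← upTo N ] G (suc i)) ∎
    where
    L = deduplicate _≟ℕ_ (parts ρ)
    G : ℕ → Carrier
    G j = pow a j * maybe′ w 0# (removePart? j ρ)
    removed : ∀ {i} → i ∈ L → w (removePart i ρ) ≈ maybe′ w 0# (removePart? i ρ)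
    removed i∈L =
      reflexive (≡.cong (maybe′ w 0#) (≡.sym (removePart?-∈ ρ (∈-deduplicate⁻ _≟ℕ_ (parts ρ) i∈L))))
    1…N-unique : Unique (applyUpTo suc N)
    1…N-unique = applyUpTo⁺₁ suc N (λ i<j _ → ℕ.<⇒≢ (s≤s i<j))
    L⊆1…N : ∀ {x} → x ∈ L → x ∈ applyUpTo suc N
    L⊆1…N x∈L with ∈-deduplicate⁻ _≟ℕ_ (parts ρ) x∈L
    ... | x∈ρ with All.lookup (pos ρ) x∈ρ
    ...   | s≤s z≤n = ∈-applyUpTo⁺ suc (ℕ.≤-trans (part≤size ρ x∈ρ) size≤N)
    G≈0 : ∀ {y} → y ∈ applyUpTo suc N → y ∉ L → G y ≈ 0#
    G≈0 _ y∉L =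
      trans (*-congˡ (reflexive (≡.cong (maybe′ w 0#) (removePart?-∉ ρ (y∉L ∘ ∈-deduplicate⁺ _≟ℕ_)))))
            (zeroʳ _)

  ⟪∣⟫-E : ∀ N a w g → deg g ≤ N → ⟪ w ∣ E a g ⟫ ≈ ⟪ shiftᵀ N a w ∣ g ⟫
  ⟪∣⟫-E N a w []            _     = refl
  ⟪∣⟫-E N a w ((k , ρ) ∷ g) deg≤N = begin
    ⟪ w ∣ ((k , ρ) ∷ R) ++ E a g ⟫
      ≈⟨ ⟪∣⟫-++ w ((k , ρ) ∷ R) (E a g) ⟩
    (k * w ρ + ⟪ w ∣ R ⟫) + ⟪ w ∣ E a g ⟫
      ≈⟨ +-cong (+-congˡ (⟪∣⟫-removals N a w k ρ size≤N)) (⟪∣⟫-E N a w g deg-g≤N) ⟩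
    (k * w ρ + k * S) + ⟪ shiftᵀ N a w ∣ g ⟫
      ≈⟨ +-congʳ (sym (distribˡ k _ _)) ⟩
    k * shiftᵀ N a w ρ + ⟪ shiftᵀ N a w ∣ g ⟫ ∎
    where
    R = map (λ i → (k * pow a i , removePart i ρ)) (deduplicate _≟ℕ_ (parts ρ))
    S = ∑[ i ← upTo N ] pow a (suc i) * maybe′ w 0# (removePart? (suc i) ρ)
    size≤N  = ℕ.m⊔n≤o⇒m≤o (size ρ) (deg g) deg≤N
    deg-g≤N = ℕ.m⊔n≤o⇒n≤o (size ρ) (deg g) deg≤N

  ⟪∣⟫-E-recursive : ∀ {M} → ShiftRecursive M → ∀ N a μ g → deg g ≤ N →
    ⟪ (λ ρ → M ρ μ) ∣ E a g ⟫ ≈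
    ⟪ (λ ρ → M ρ μ) ∣ g ⟫ + (∑[ i ← upTo N ] pow a (suc i) * ⟪ (λ ρ → M ρ (insertPart (suc i) μ)) ∣ g ⟫)
  ⟪∣⟫-E-recursive {M} rec N a μ g deg≤N = begin
    ⟪ (λ ρ → M ρ μ) ∣ E a g ⟫
      ≈⟨ ⟪∣⟫-E N a _ g deg≤N ⟩
    ⟪ shiftᵀ N a (λ ρ → M ρ μ) ∣ g ⟫
      ≈⟨ ⟪∣⟫-cong g (λ ρ → +-congˡ (∑-cong (upTo N) (λ i → *-congˡ (sym (rec ρ μ i))))) ⟩
    ⟪ (λ ρ → M ρ μ + (∑[ i ← upTo N ] pow a (suc i) * M ρ (insertPart (suc i) μ))) ∣ g ⟫
      ≈⟨ ⟪∣⟫-+ _ _ g ⟩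
    ⟪ (λ ρ → M ρ μ) ∣ g ⟫ + ⟪ (λ ρ → ∑[ i ← upTo N ] pow a (suc i) * M ρ (insertPart (suc i) μ)) ∣ g ⟫
      ≈⟨ +-congˡ (⟪∣⟫-∑ (λ i → pow a (suc i)) (λ i ρ → M ρ (insertPart (suc i) μ)) (upTo N) g) ⟩
    ⟪ (λ ρ → M ρ μ) ∣ g ⟫ + (∑[ i ← upTo N ] pow a (suc i) * ⟪ (λ ρ → M ρ (insertPart (suc i) μ)) ∣ g ⟫) ∎

  coeff≈⟪removalMatrix⟫ : ∀ f μ → coeff f μ ≈ ⟪ (λ ρ → removalMatrix (λ σ → δ σ ∅) ρ μ) ∣ f ⟫
  coeff≈⟪removalMatrix⟫ f μ = trans (coeff≈⟪δ⟫ f μ) (⟪∣⟫-cong f (λ ρ → δ≈removalMatrix ρ μ))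

  coeff-E : ∀ N a h μ → deg h ≤ N →
    coeff (E a h) μ ≈ coeff h μ + (∑[ i ← upTo N ] pow a (suc i) * coeff h (insertPart (suc i) μ))
  coeff-E N a h μ deg≤N = begin
    coeff (E a h) μ
      ≈⟨ coeff≈⟪removalMatrix⟫ (E a h) μ ⟩
    ⟪ (λ ρ → M ρ μ) ∣ E a h ⟫
      ≈⟨ ⟪∣⟫-E-recursive (removalMatrix-recursive _) N a μ h deg≤N ⟩
    ⟪ (λ ρ → M ρ μ) ∣ h ⟫ + (∑[ i ← upTo N ] pow a (suc i) * ⟪ (λ ρ → M ρ (insertPart (suc i) μ)) ∣ h ⟫)
      ≈⟨ sym (+-cong (coeff≈⟪removalMatrix⟫ h μ)
                     (∑-cong (upTo N) (λ i → *-congˡ (coeff≈⟪removalMatrix⟫ h _)))) ⟩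
    coeff h μ + (∑[ i ← upTo N ] pow a (suc i) * coeff h (insertPart (suc i) μ)) ∎
    where M = removalMatrix (λ σ → δ σ ∅)

  recursive⇒commuting : ∀ θ → ShiftRecursive (matrix θ) → ∀ a f → E a (fun θ f) ≈Λ fun θ (E a f)
  recursive⇒commuting θ rec a f μ = begin
    coeff (E a (fun θ f)) μ
      ≈⟨ coeff-E N a (fun θ f) μ (ℕ.m≤m⊔n _ _) ⟩
    coeff (fun θ f) μ + (∑[ i ← upTo N ] pow a (suc i) * coeff (fun θ f) (insertPart (suc i) μ))
      ≈⟨ +-cong (coeff-fun θ f μ) (∑-cong (upTo N) (λ i → *-congˡ (coeff-fun θ f _))) ⟩
    ⟪ (λ ρ → M ρ μ) ∣ f ⟫ + (∑[ i ← upTo N ] pow a (suc i) * ⟪ (λ ρ → M ρ (insertPart (suc i) μ)) ∣ f ⟫)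
      ≈⟨ sym (⟪∣⟫-E-recursive rec N a μ f (ℕ.m≤n⊔m _ _)) ⟩
    ⟪ (λ ρ → M ρ μ) ∣ E a f ⟫
      ≈⟨ sym (coeff-fun θ (E a f) μ) ⟩
    coeff (fun θ (E a f)) μ ∎
    where
    M = matrix θ
    N = deg (fun θ f) ⊔ℕ deg f

  -- Compare the coefficients of a^(1+i) in the commutation relation applied to m ρ.
  commuting⇒recursive : ∀ θ → (∀ a f → E a (fun θ f) ≈Λ fun θ (E a f)) → ShiftRecursive (matrix θ)
  commuting⇒recursive θ commutes ρ μ i = coefficients-unique N _ _ same-polynomial i i<N
    where
    M = matrix θ
    N = deg (fun θ (m ρ)) ⊔ℕ (size ρ ⊔ℕ suc i)
    i<N : i < N
    i<N = ℕ.≤-trans (ℕ.m≤n⊔m (size ρ) (suc i)) (ℕ.m≤n⊔m (deg (fun θ (m ρ))) _)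
    deg-mρ≤N : deg (m ρ) ≤ N
    deg-mρ≤N = ℕ.≤-trans (ℕ.≤-reflexive (ℕ.⊔-identityʳ (size ρ)))
                 (ℕ.≤-trans (ℕ.m≤m⊔n (size ρ) (suc i)) (ℕ.m≤n⊔m (deg (fun θ (m ρ))) _))
    same-polynomial : ∀ a →
      ∑[ j ← upTo N ] pow a (suc j) * M ρ (insertPart (suc j) μ) ≈
      ∑[ j ← upTo N ] pow a (suc j) * maybe′ (λ τ → M τ μ) 0# (removePart? (suc j) ρ)
    same-polynomial a = ∙-cancelˡ (M ρ μ) _ _ (begin
      M ρ μ + (∑[ j ← upTo N ] pow a (suc j) * M ρ (insertPart (suc j) μ))
        ≈⟨ sym (coeff-E N a (fun θ (m ρ)) μ (ℕ.m≤m⊔n _ _)) ⟩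
      coeff (E a (fun θ (m ρ))) μ  ≈⟨ commutes a (m ρ) μ ⟩
      coeff (fun θ (E a (m ρ))) μ  ≈⟨ coeff-fun θ (E a (m ρ)) μ ⟩
      ⟪ (λ σ → M σ μ) ∣ E a (m ρ) ⟫ ≈⟨ ⟪∣⟫-E N a _ (m ρ) deg-mρ≤N ⟩
      ⟪ shiftᵀ N a (λ σ → M σ μ) ∣ m ρ ⟫ ≈⟨ ⟪∣⟫-m (shiftᵀ N a (λ σ → M σ μ)) ρ ⟩
      shiftᵀ N a (λ σ → M σ μ) ρ ∎)

  infixl 7 _·∏!_
  _·∏!_ : Carrier → List ℕ → Carrier
  k ·∏! []       = k
  k ·∏! (x ∷ xs) = (k ·∏! xs) * fromℕ (x !)

  ·∏!-*ˡ : ∀ k xs → k ·∏! xs ≈ k * (1# ·∏! xs)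
  ·∏!-*ˡ k []       = sym (*-identityʳ k)
  ·∏!-*ˡ k (x ∷ xs) = trans (*-congʳ (·∏!-*ˡ k xs)) (*-assoc k _ _)

  ·∏!-nonzero : ∀ xs → ¬ (1# ·∏! xs) ≈ 0#
  ·∏!-nonzero []       1≈0 = charZero 0 (trans (+-identityʳ 1#) 1≈0)
  ·∏!-nonzero (x ∷ xs) p≈0 = fromℕ-nonzero (x !) {{x !≢0}} (cancelˡ (·∏!-nonzero xs) p≈0)
    where
    fromℕ-nonzero : ∀ n .{{_ : NonZero n}} → ¬ fromℕ n ≈ 0#
    fromℕ-nonzero (suc n) = charZero n

  monomial : Carrier → Maybe Partition → Λ
  monomial k = maybe′ (λ σ → (k , σ) ∷ []) []

  coeff-monomial : ∀ k m μ → coeff (monomial k m) μ ≈ k * maybe′ (λ σ → δ σ μ) 0# m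
  coeff-monomial k nothing  μ = sym (zeroʳ k)
  coeff-monomial k (just σ) μ = trans (coeff≈⟪δ⟫ ((k , σ) ∷ []) μ) (+-identityʳ _)

  D-monomial : ∀ x k m → D x (monomial k m) ≡ monomial (k * fromℕ (x !)) (m >>= removePart? x)
  D-monomial x k nothing  = ≡.refl
  D-monomial x k (just σ) with any? (x ≟ℕ_) (parts σ)
  ... | yes _ = ≡.refl
  ... | no  _ = ≡.refl

  Dν-monomial : ∀ k ρ xs → foldr D ((k , ρ) ∷ []) xs ≡ monomial (k ·∏! xs) (ρ ∖ xs)
  Dν-monomial k ρ []       = ≡.refl
  Dν-monomial k ρ (x ∷ xs) = ≡.trans (≡.cong (D x) (Dν-monomial k ρ xs)) (D-monomial x (k ·∏! xs) (ρ ∖ xs))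

  D-++ : ∀ i f g → D i (f ++ g) ≡ D i f ++ D i g
  D-++ i []      g = ≡.refl
  D-++ i (t ∷ f) g = ≡.trans (≡.cong (_ ++_) (D-++ i f g)) (≡.sym (++-assoc _ (D i f) (D i g)))

  foldr-D-++ : ∀ xs f g → foldr D (f ++ g) xs ≡ foldr D f xs ++ foldr D g xs
  foldr-D-++ []       f g = ≡.refl
  foldr-D-++ (x ∷ xs) f g =
    ≡.trans (≡.cong (D x) (foldr-D-++ xs f g)) (D-++ x (foldr D f xs) (foldr D g xs))

  foldr-D-[] : ∀ xs → foldr D [] xs ≡ []
  foldr-D-[] []       = ≡.refl
  foldr-D-[] (x ∷ xs) = ≡.cong (D x) (foldr-D-[] xs)

  Dν-matrix : Partition → Partition → Partition → Carrier
  Dν-matrix ν ρ μ = (1# ·∏! parts ν) * maybe′ (λ σ → δ σ μ) 0# (ρ ∖ parts ν)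

  coeff-Dν : ∀ ν f μ → coeff (Dν ν f) μ ≈ ⟪ (λ ρ → Dν-matrix ν ρ μ) ∣ f ⟫
  coeff-Dν ν []            μ = reflexive (≡.cong (λ g → coeff g μ) (foldr-D-[] (parts ν)))
  coeff-Dν ν ((k , ρ) ∷ f) μ = begin
    coeff (foldr D (((k , ρ) ∷ []) ++ f) (parts ν)) μ
      ≡⟨ ≡.cong (λ g → coeff g μ) (foldr-D-++ (parts ν) ((k , ρ) ∷ []) f) ⟩
    coeff (foldr D ((k , ρ) ∷ []) (parts ν) ++ Dν ν f) μ
      ≈⟨ coeff-++ (foldr D ((k , ρ) ∷ []) (parts ν)) (Dν ν f) μ ⟩
    coeff (foldr D ((k , ρ) ∷ []) (parts ν)) μ + coeff (Dν ν f) μ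
      ≡⟨ ≡.cong (λ g → coeff g μ + coeff (Dν ν f) μ) (Dν-monomial k ρ (parts ν)) ⟩
    coeff (monomial (k ·∏! parts ν) (ρ ∖ parts ν)) μ + coeff (Dν ν f) μ
      ≈⟨ +-cong (trans (coeff-monomial _ (ρ ∖ parts ν) μ)
                       (trans (*-congʳ (·∏!-*ˡ k (parts ν))) (*-assoc k _ _)))
                (coeff-Dν ν f μ) ⟩
    k * Dν-matrix ν ρ μ + ⟪ (λ ρ → Dν-matrix ν ρ μ) ∣ f ⟫ ∎

  ∑-partitionsUpTo-single : ∀ {H : Partition → Carrier} N ν₀ → size ν₀ ≤ N → (∀ ν → ν ≢ ν₀ → H ν ≈ 0#) →
                            ∑ H (partitionsUpTo N) ≈ H ν₀
  ∑-partitionsUpTo-single {H} N ν₀ size≤N H≈0 = begin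
    ∑ H (mapMaybe isPartition? (compositions N N))
      ≈⟨ ∑-mapMaybe H isPartition? (compositions N N) ⟩
    ∑[ l ← compositions N N ] maybe′ H 0# (isPartition? l)
      ≈⟨ ∑-compositions-single N N (parts ν₀) (pos ν₀) size≤N (ℕ.≤-trans (length≤size ν₀) size≤N) G≈0 ⟩
    maybe′ H 0# (isPartition? (parts ν₀))
      ≡⟨ ≡.cong (maybe′ H 0#) (isPartition?-complete ν₀) ⟩
    H ν₀ ∎
    where
    G≈0 : ∀ l → l ≢ parts ν₀ → maybe′ H 0# (isPartition? l) ≈ 0#
    G≈0 l l≢ν₀ = go (isPartition? l) ≡.refl
      where
      go : ∀ m → isPartition? l ≡ m → maybe′ H 0# m ≈ 0#
      go nothing  _ = refl
      go (just ν) e = H≈0 ν (λ { ≡.refl → l≢ν₀ (≡.sym (isPartition?-sound e)) })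

  seriesMatrix : (Partition → Carrier) → Partition → Partition → Carrier
  seriesMatrix cf = removalMatrix (λ ν → cf ν * (1# ·∏! parts ν))

  -- Among all ν, only ν = ρ ∖ μ satisfies ρ ∖ ν = μ.
  ∑-Dν-matrix : ∀ cf N ρ μ → size ρ ≤ N →
    ∑[ ν ← partitionsUpTo N ] cf ν * Dν-matrix ν ρ μ ≈ seriesMatrix cf ρ μ
  ∑-Dν-matrix cf N ρ μ size≤N = go (ρ ∖ parts μ) ≡.refl
    where
    H : Partition → Carrier
    H ν = cf ν * Dν-matrix ν ρ μ
    H≈0 : ∀ ν → ρ ∖ parts ν ≢ just μ → H ν ≈ 0#
    H≈0 ν miss = trans (*-congˡ (trans (*-congˡ (δ-miss (ρ ∖ parts ν) miss)) (zeroʳ _))) (zeroʳ _)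
    go : ∀ m → ρ ∖ parts μ ≡ m → ∑ H (partitionsUpTo N) ≈ maybe′ (λ ν → cf ν * (1# ·∏! parts ν)) 0# m
    go nothing  e = ∑-zero (partitionsUpTo N) λ {ν} _ →
      H≈0 ν (λ e′ → contradiction (≡.trans (≡.sym e) (∖-complement {ρ} {ν} e′)) λ ())
    go (just σ) e = begin
      ∑ H (partitionsUpTo N)
        ≈⟨ ∑-partitionsUpTo-single N σ (ℕ.≤-trans (∖-size (parts μ) e) size≤N)
             (λ ν ν≢σ → H≈0 ν (λ e′ → ν≢σ (just-injective (≡.trans (≡.sym (∖-complement {ρ} {ν} e′)) e)))) ⟩
      cf σ * ((1# ·∏! parts σ) * maybe′ (λ σ′ → δ σ′ μ) 0# (ρ ∖ parts σ))
        ≡⟨ ≡.cong (λ m → cf σ * ((1# ·∏! parts σ) * maybe′ (λ σ′ → δ σ′ μ) 0# m)) (∖-complement {ρ} {μ} e) ⟩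
      cf σ * ((1# ·∏! parts σ) * δ μ μ)
        ≈⟨ *-congˡ (trans (*-congˡ (δ-diag μ)) (*-identityʳ _)) ⟩
      cf σ * (1# ·∏! parts σ) ∎

  coeff-series : ∀ cf f μ → coeff (series cf f) μ ≈ ⟪ (λ ρ → seriesMatrix cf ρ μ) ∣ f ⟫
  coeff-series cf f μ = begin
    coeff (series cf f) μ
      ≈⟨ coeff≈⟪δ⟫ (series cf f) μ ⟩
    ⟪ (λ σ → δ σ μ) ∣ concatMap (λ ν → scale (cf ν) (Dν ν f)) Ps ⟫
      ≈⟨ ∑-concatMap _ (λ ν → scale (cf ν) (Dν ν f)) Ps ⟩
    ∑[ ν ← Ps ] ⟪ (λ σ → δ σ μ) ∣ scale (cf ν) (Dν ν f) ⟫
      ≈⟨ ∑-cong Ps (λ ν → trans (sym (coeff≈⟪δ⟫ (scale (cf ν) (Dν ν f)) μ))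
                         (trans (coeff-scale (cf ν) (Dν ν f) μ) (*-congˡ (coeff-Dν ν f μ)))) ⟩
    ∑[ ν ← Ps ] cf ν * ⟪ (λ ρ → Dν-matrix ν ρ μ) ∣ f ⟫
      ≈⟨ sym (⟪∣⟫-∑ cf (λ ν ρ → Dν-matrix ν ρ μ) Ps f) ⟩
    ⟪ (λ ρ → ∑[ ν ← Ps ] cf ν * Dν-matrix ν ρ μ) ∣ f ⟫
      ≈⟨ ⟪∣⟫-cong-deg (deg f) f ℕ.≤-refl (λ ρ size≤ → ∑-Dν-matrix cf (deg f) ρ μ size≤) ⟩
    ⟪ (λ ρ → seriesMatrix cf ρ μ) ∣ f ⟫ ∎
    where Ps = partitionsUpTo (deg f)

  seriesCoefficient : LinOp → Partition → Carrier
  seriesCoefficient θ ν = matrix θ ν ∅ * proj₁ (inverse (1# ·∏! parts ν) (·∏!-nonzero (parts ν)))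

  seriesCoefficient-·∏! : ∀ θ ν → seriesCoefficient θ ν * (1# ·∏! parts ν) ≈ matrix θ ν ∅
  seriesCoefficient-·∏! θ ν = begin
    (matrix θ ν ∅ * y) * p ≈⟨ *-assoc _ y p ⟩
    matrix θ ν ∅ * (y * p) ≈⟨ *-congˡ (trans (*-comm y p) (proj₂ p⁻¹)) ⟩
    matrix θ ν ∅ * 1#      ≈⟨ *-identityʳ _ ⟩
    matrix θ ν ∅           ∎
    where
    p = 1# ·∏! parts ν
    p⁻¹ = inverse p (·∏!-nonzero (parts ν))
    y = proj₁ p⁻¹

  recursive⇒series : ∀ θ → ShiftRecursive (matrix θ) → ∀ f → fun θ f ≈Λ series (seriesCoefficient θ) f
  recursive⇒series θ rec f μ = begin
    coeff (fun θ f) μ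
      ≈⟨ coeff-fun θ f μ ⟩
    ⟪ (λ ρ → matrix θ ρ μ) ∣ f ⟫
      ≈⟨ ⟪∣⟫-cong f (λ ρ → trans (recursive⇒removalMatrix rec ρ μ)
                       (maybe′-cong (ρ ∖ parts μ) (sym ∘ seriesCoefficient-·∏! θ))) ⟩
    ⟪ (λ ρ → seriesMatrix (seriesCoefficient θ) ρ μ) ∣ f ⟫
      ≈⟨ sym (coeff-series (seriesCoefficient θ) f μ) ⟩
    coeff (series (seriesCoefficient θ) f) μ ∎

  series⇒recursive : ∀ θ cf → (∀ f → fun θ f ≈Λ series cf f) → ShiftRecursive (matrix θ)
  series⇒recursive θ cf θ≈series = ShiftRecursive-resp seriesMatrix≈matrix (removalMatrix-recursive _)
    where
    seriesMatrix≈matrix : ∀ ρ μ → seriesMatrix cf ρ μ ≈ matrix θ ρ μ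
    seriesMatrix≈matrix ρ μ =
      sym (trans (θ≈series (m ρ) μ) (trans (coeff-series cf (m ρ) μ) (⟪∣⟫-m (λ ρ → seriesMatrix cf ρ μ) ρ)))

theorem3 : ∀ {c ℓ} (K : CharZeroField c ℓ) (θ : Sym.LinOp K) →
    let open Sym K in
    ((∀ (a : CharZeroField.Carrier K) (f : Λ) → E a (fun θ f) ≈Λ fun θ (E a f))
      ⇔ Σ (Partition → CharZeroField.Carrier K) (λ cf → ∀ (f : Λ) → fun θ f ≈Λ series cf f))
theorem3 K θ = mk⇔
  (λ commutes → seriesCoefficient θ , recursive⇒series θ (commuting⇒recursive θ commutes))
  (λ (cf , θ≈series) → recursive⇒commuting θ (series⇒recursive θ cf θ≈series))
  where open SymmetricFunctions K
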